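{- The set \[ F=\left\{\left.\begin{pmatrix} x & y & z\\ x' & y' & z'\end{pmatrix}\in \mathcal{M}^{+}_{\mathbb{Z}}\ \right|\ xyz\ \geq\ 2xx',\ 2yy',\ 2zz'\right\} \] is a fundamental domain for the action of $\Gamma$ on $\mathcal{M}^{\mathrm{CP}}_{\mathbb{Z}}$; that is, $F\subset \mathcal{M}^{\mathrm{CP}}_{\mathbb{Z}}$ and, for every $M\in\mathcal{M}^{\mathrm{CP}}_{\mathbb{Z}}$, the set $\Gamma(M)\cap F$ is a singleton. Moreover, the element of $\Gamma(M)\cap F$ is the smallest element of $\Gamma(M)$ with respect to the entrywise partial order $\leq$.
   Context: $\mathcal{M}$ is the set of real $2\times 3$ arrays $M=\begin{pmatrix} x & y & z\\ x' & y' & z'\end{pmatrix}$ with $xyz=x'y'z'$ and each column's two entries of the same sign; such $M$ encodes the skew-symmetrizable matrix $B=\begin{pmatrix}0&-z'&y\\ z&0&-x'\\ -y'&x&0\end{pmatrix}$. $\mathcal{M}^{+}$ is the subset with all entries positive, and $\mathcal{M}^{+}_{\mathbb{Z}}$ the subset of $\mathcal{M}^{+}$ with integer entries. The maps $\gamma_k$ are $\gamma_1(M)=\begin{pmatrix} y'z'-x & y & z\\ yz-x' & y' & z'\end{pmatrix}$, $\gamma_2(M)=\begin{pmatrix} x & z'x'-y & z\\ x' & zx-y' & z'\end{pmatrix}$, $\gamma_3(M)=\begin{pmatrix} x & y & x'y'-z\\ x' & y' & xy-z'\end{pmatrix}$ (these are $-\mu_k$ on cyclic matrices), and $\Gamma$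 is the group they generate; $\Gamma(M)$ is the set of all $\gamma_{t_k}\cdots\gamma_{t_1}(M)$ over finite index sequences with $t_i\neq t_{i+1}$. An element $M\in\mathcal{M}^{+}$ is cluster-positive if every element of $\Gamma(M)$ has all entries positive; $\mathcal{M}^{\mathrm{CP}}_{\mathbb{Z}}$ is the set of cluster-positive elements with integer entries. The order $\leq$ on $\mathcal{M}$ is the entrywise order. -}

module Defs where

open import Data.Integer using (ℤ; +_; _+_; _-_; _*_; _≤_; _<_)
open import Data.Fin using (Fin; zero; suc)
open import Data.List using (List; []; _∷_)
open import Data.Product using (_×_; Σ; ∃; _,_)
open import Data.Empty using (⊥)
open import Data.Unit using (⊤)
open import Relation.Binary.PropositionalEquality using (_≡_)
open import Relation.Nullary using (¬_)

record Arr : Set where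
  constructor arr
  field
    x y z x' y' z' : ℤ
open Arr public

-- M ∈ 𝓜⁺_ℤ : integer entries, all positive, and xyz = x'y'z'
-- (the same-sign condition on columns is automatic for positive entries)
InMPlusZ : Arr → Set
InMPlusZ (arr a b c a' b' c') =
  (+ 0 < a) × (+ 0 < b) × (+ 0 < c) × (+ 0 < a') × (+ 0 < b') × (+ 0 < c')
  × (a * b * c ≡ a' * b' * c')

AllPositive : Arr → Set
AllPositive (arr a b c a' b' c') =
  (+ 0 < a) × (+ 0 < b) × (+ 0 < c) × (+ 0 < a') × (+ 0 < b') × (+ 0 < c')

-- the maps γ₁, γ₂, γ₃ (indexed by Fin 3 : zero ↦ γ₁, suc zero ↦ γ₂, suc (suc zero) ↦ γ₃)
γ : Fin 3 → Arr → Arr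
γ zero             (arr a b c a' b' c') = arr (b' * c' - a) b c (b * c - a') b' c'
γ (suc zero)       (arr a b c a' b' c') = arr a (c' * a' - b) c a' (c * a - b') c'
γ (suc (suc zero)) (arr a b c a' b' c') = arr a b (a' * b' - c) a' b' (a * b - c')

applySeq : List (Fin 3) → Arr → Arr
applySeq []       M = M
applySeq (t ∷ ts) M = applySeq ts (γ t M)

NoAdjRepeat : List (Fin 3) → Set
NoAdjRepeat []            = ⊤
NoAdjRepeat (t ∷ [])      = ⊤
NoAdjRepeat (t ∷ s ∷ ts)  = (¬ t ≡ s) × NoAdjRepeat (s ∷ ts)

InOrbit : Arr → Arr → Set
InOrbit M N = Σ (List (Fin 3)) λ ts → NoAdjRepeat ts × applySeq ts M ≡ N

ClusterPositiveZ : Arr → Set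
ClusterPositiveZ M = InMPlusZ M × (∀ N → InOrbit M N → AllPositive N)

InF : Arr → Set
InF M@(arr a b c a' b' c') =
  InMPlusZ M
  × (+ 2 * a * a' ≤ a * b * c)
  × (+ 2 * b * b' ≤ a * b * c)
  × (+ 2 * c * c' ≤ a * b * c)

_≤ₑ_ : Arr → Arr → Set
arr a b c a' b' c' ≤ₑ arr d e f d' e' f' =
  (a ≤ d) × (b ≤ e) × (c ≤ f) × (a' ≤ d') × (b' ≤ e') × (c' ≤ f')

module Submission where

-- If M ∈ F, every mutation of M is increasing: for the mutated column, 2x ≤ y'z' and 2x' ≤ yz
-- (these are equivalent to xyz ≥ 2xx' since xyz = x'y'z'). This propagates along reduced words:
-- after an increasing mutation at k, column k satisfies the reverse inequalities, every other column
-- is still increasing, and all column products xx' are at least 4; a further mutation at any j ≠ k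
-- preserves these three facts. Hence every element of Γ(M) dominates M entrywise, so M is
-- cluster-positive and is the minimum of its orbit, which also gives uniqueness. Conversely, if a
-- cluster-positive M violates xyz ≥ 2xx', the mutation at that column strictly decreases x and x',
-- so descent on the sum of the entries reaches F.

open import Data.Empty using (⊥-elim)
open import Data.Fin using (Fin; zero; suc)
open import Data.Fin.Properties using (_≟_)
open import Data.Integer using (ℤ; +_; _+_; _-_; -_; _*_; _≤_; _<_; 0ℤ; ∣_∣; +≤+; +<+)
open import Data.Integer.Base using (nonNegative; positive)
open import Data.Integer.Properties
  using (≤-refl; ≤-trans; <-≤-trans; <⇒≤; ≰⇒>; ≤-antisym; _≤?_; i≤j⇒0≤j-i; neg-mono-≤;
         +-identityʳ; +-mono-≤; +-monoˡ-≤; +-monoʳ-≤; +-mono-<; +-monoˡ-<; +-monoʳ-<;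
         *-comm; *-assoc; *-monoʳ-≤-nonNeg; *-monoˡ-≤-nonNeg; *-cancelʳ-≤-pos; *-cancelˡ-≤-pos;
         module ≤-Reasoning)
open import Data.Integer.Tactic.RingSolver using (solve-∀)
open import Data.List using (List; []; _∷_; _++_; reverse)
open import Data.List.Properties using (unfold-reverse)
import Data.Nat as ℕ
open import Data.Nat.Induction using (<-wellFounded)
open import Data.Product using (Σ; _×_; _,_; proj₁; proj₂)
open import Data.Sum using (_⊎_; inj₁; inj₂)
open import Data.Unit using (tt)
open import Function.Base using (_∘_)
open import Function.Bundles using (_⇔_; mk⇔; Equivalence)
open import Induction.WellFounded using (Acc; acc)
open import Relation.Binary.PropositionalEquality
  using (_≡_; refl; sym; trans; cong; cong₂; subst; subst₂; module ≡-Reasoning)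
open import Relation.Nullary using (¬_; Dec; yes; no)

open import Defs

u≤p-u : ∀ {u p} → + 2 * u ≤ p → u ≤ p - u
u≤p-u {u} {p} 2u≤p = begin
  u            ≡⟨ sym (2u-u≡u u) ⟩
  + 2 * u - u  ≤⟨ +-monoˡ-≤ (- u) 2u≤p ⟩
  p - u        ∎
  where
  open ≤-Reasoning
  2u-u≡u : ∀ u → + 2 * u - u ≡ u
  2u-u≡u = solve-∀

p≤2[p-u] : ∀ {u p} → + 2 * u ≤ p → p ≤ + 2 * (p - u)
p≤2[p-u] {u} {p} 2u≤p = begin
  p                    ≡⟨ sym (+-identityʳ p) ⟩
  p + 0ℤ               ≤⟨ +-monoʳ-≤ p (i≤j⇒0≤j-i 2u≤p) ⟩
  p + (p - + 2 * u)    ≡⟨ expand u p ⟩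
  + 2 * (p - u)        ∎
  where
  open ≤-Reasoning
  expand : ∀ u p → p + (p - + 2 * u) ≡ + 2 * (p - u)
  expand = solve-∀

p<2u⇒p-u<u : ∀ {u p} → p < + 2 * u → p - u < u
p<2u⇒p-u<u {u} {p} p<2u = begin-strict
  p - u        <⟨ +-monoˡ-< (- u) p<2u ⟩
  + 2 * u - u  ≡⟨ 2u-u≡u u ⟩
  u            ∎
  where
  open ≤-Reasoning
  2u-u≡u : ∀ u → + 2 * u - u ≡ u
  2u-u≡u = solve-∀

2u≤s*u-t : ∀ {s t u P} → 0ℤ ≤ u → + 4 ≤ s → t ≤ + 2 * u → s * u - t ≡ P → + 2 * u ≤ P
2u≤s*u-t {s} {t} {u} {P} 0≤u 4≤s t≤2u su-t≡P = begin
  + 2 * u              ≡⟨ 4u-2u u ⟩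
  + 4 * u - + 2 * u    ≤⟨ +-mono-≤ (*-monoʳ-≤-nonNeg u {{nonNegative 0≤u}} 4≤s) (neg-mono-≤ t≤2u) ⟩
  s * u - t            ≡⟨ su-t≡P ⟩
  P                    ∎
  where
  open ≤-Reasoning
  4u-2u : ∀ u → + 2 * u ≡ + 4 * u - + 2 * u
  4u-2u = solve-∀

*-mono-≤-nonNeg : ∀ {i j k l} → 0ℤ ≤ i → 0ℤ ≤ k → i ≤ j → k ≤ l → i * k ≤ j * l
*-mono-≤-nonNeg {i} {j} {k} {l} 0≤i 0≤k i≤j k≤l = begin
  i * k  ≤⟨ *-monoʳ-≤-nonNeg k {{nonNegative 0≤k}} i≤j ⟩
  j * k  ≤⟨ *-monoˡ-≤-nonNeg j {{nonNegative (≤-trans 0≤i i≤j)}} k≤l ⟩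
  j * l  ∎
  where open ≤-Reasoning

2u≤vw⇒2v≤w'u⇒4≤w'w : ∀ {u v} w w' → 0ℤ < u → 0ℤ < v →
                     + 2 * u ≤ v * w → + 2 * v ≤ w' * u → + 4 ≤ w' * w
2u≤vw⇒2v≤w'u⇒4≤w'w {u} {v} w w' 0<u 0<v 2u≤vw 2v≤w'u =
  *-cancelˡ-≤-pos (+ 4) (w' * w) v {{positive 0<v}}
    (*-cancelˡ-≤-pos (v * + 4) (v * (w' * w)) u {{positive 0<u}} (begin
      u * (v * + 4)           ≡⟨ left u v ⟩
      + 2 * u * (+ 2 * v)     ≤⟨ *-mono-≤-nonNeg (nonNeg2* 0<u) (nonNeg2* 0<v) 2u≤vw 2v≤w'u ⟩
      v * w * (w' * u)        ≡⟨ right u v w w' ⟩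
      u * (v * (w' * w))      ∎))
  where
  open ≤-Reasoning
  nonNeg2* : ∀ {i} → 0ℤ < i → 0ℤ ≤ + 2 * i
  nonNeg2* {i} 0<i = *-monoˡ-≤-nonNeg (+ 2) (<⇒≤ 0<i)
  left : ∀ u v → u * (v * + 4) ≡ + 2 * u * (+ 2 * v)
  left = solve-∀
  right : ∀ u v w w' → v * w * (w' * u) ≡ u * (v * (w' * w))
  right = solve-∀

*-monoʳ-≤-positive : ∀ {i j k} → 0ℤ < k → i ≤ j → i * k ≤ j * k
*-monoʳ-≤-positive {k = k} 0<k = *-monoʳ-≤-nonNeg k {{nonNegative (<⇒≤ 0<k)}}

*-monoˡ-≤-positive : ∀ {i j k} → 0ℤ < k → i ≤ j → k * i ≤ k * j
*-monoˡ-≤-positive {k = k} 0<k = *-monoˡ-≤-nonNeg k {{nonNegative (<⇒≤ 0<k)}}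

*-cancelʳ-≤-⇔ : ∀ {k m n p q} → 0ℤ < k → k * p ≡ q → n ≡ m * k → (n ≤ q ⇔ m ≤ p)
*-cancelʳ-≤-⇔ {k} {m} {n} {p} {q} 0<k kp≡q n≡mk = mk⇔ to from
  where
  open ≤-Reasoning
  kp≡pk : q ≡ p * k
  kp≡pk = trans (sym kp≡q) (*-comm k p)
  to : n ≤ q → m ≤ p
  to n≤q = *-cancelʳ-≤-pos m p k {{positive 0<k}}
             (subst₂ _≤_ n≡mk kp≡pk n≤q)
  from : m ≤ p → n ≤ q
  from m≤p = begin
    n      ≡⟨ n≡mk ⟩
    m * k  ≤⟨ *-monoʳ-≤-positive 0<k m≤p ⟩
    p * k  ≡⟨ sym kp≡pk ⟩
    q      ∎

0≤i⇒i<j⇒∣i∣<∣j∣ : ∀ {i j} → 0ℤ ≤ i → i < j → ∣ i ∣ ℕ.< ∣ j ∣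
0≤i⇒i<j⇒∣i∣<∣j∣ (+≤+ _) (+<+ m<n) = m<n

entry entry' cofactor cofactor' : Fin 3 → Arr → ℤ
entry zero             = x
entry (suc zero)       = y
entry (suc (suc zero)) = z
entry' zero             = x'
entry' (suc zero)       = y'
entry' (suc (suc zero)) = z'
cofactor zero             N = y N * z N
cofactor (suc zero)       N = z N * x N
cofactor (suc (suc zero)) N = x N * y N
cofactor' zero             N = y' N * z' N
cofactor' (suc zero)       N = z' N * x' N
cofactor' (suc (suc zero)) N = x' N * y' N

product product' : Arr → ℤ
product  N = x N * y N * z N
product' N = x' N * y' N * z' N

Balanced : Arr → Set
Balanced N = product N ≡ product' N

entry-γ : ∀ k N → entry k (γ k N) ≡ cofactor' k N - entry k N
entry-γ zero             N = refl
entry-γ (suc zero)       N = refl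
entry-γ (suc (suc zero)) N = refl

entry'-γ : ∀ k N → entry' k (γ k N) ≡ cofactor k N - entry' k N
entry'-γ zero             N = refl
entry'-γ (suc zero)       N = refl
entry'-γ (suc (suc zero)) N = refl

cofactor-γ : ∀ k N → cofactor k (γ k N) ≡ cofactor k N
cofactor-γ zero             N = refl
cofactor-γ (suc zero)       N = refl
cofactor-γ (suc (suc zero)) N = refl

cofactor'-γ : ∀ k N → cofactor' k (γ k N) ≡ cofactor' k N
cofactor'-γ zero             N = refl
cofactor'-γ (suc zero)       N = refl
cofactor'-γ (suc (suc zero)) N = refl

b*[c*a]≡a*b*c : ∀ a b c → b * (c * a) ≡ a * b * c
b*[c*a]≡a*b*c = solve-∀

entry*cofactor≡product : ∀ k N → entry k N * cofactor k N ≡ product N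
entry*cofactor≡product zero             N = sym (*-assoc (x N) (y N) (z N))
entry*cofactor≡product (suc zero)       N = b*[c*a]≡a*b*c (x N) (y N) (z N)
entry*cofactor≡product (suc (suc zero)) N = *-comm (z N) (x N * y N)

entry'*cofactor'≡product' : ∀ k N → entry' k N * cofactor' k N ≡ product' N
entry'*cofactor'≡product' zero             N = sym (*-assoc (x' N) (y' N) (z' N))
entry'*cofactor'≡product' (suc zero)       N = b*[c*a]≡a*b*c (x' N) (y' N) (z' N)
entry'*cofactor'≡product' (suc (suc zero)) N = *-comm (z' N) (x' N * y' N)

[p-e]*c≡p*c-e*c : ∀ p e c → (p - e) * c ≡ p * c - e * c
[p-e]*c≡p*c-e*c = solve-∀

product-γ : ∀ k N → product (γ k N) ≡ cofactor' k N * cofactor k N - product N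
product-γ k N = begin
  product (γ k N)                                          ≡⟨ sym (entry*cofactor≡product k (γ k N)) ⟩
  entry k (γ k N) * cofactor k (γ k N)                     ≡⟨ cong₂ _*_ (entry-γ k N) (cofactor-γ k N) ⟩
  (cofactor' k N - entry k N) * cofactor k N               ≡⟨ [p-e]*c≡p*c-e*c (cofactor' k N) (entry k N) (cofactor k N) ⟩
  cofactor' k N * cofactor k N - entry k N * cofactor k N  ≡⟨ cong (λ P → cofactor' k N * cofactor k N - P) (entry*cofactor≡product k N) ⟩
  cofactor' k N * cofactor k N - product N                 ∎
  where open ≡-Reasoning

product'-γ : ∀ k N → product' (γ k N) ≡ cofactor k N * cofactor' k N - product' N
product'-γ k N = begin
  product' (γ k N)                                            ≡⟨ sym (entry'*cofactor'≡product' k (γ k N)) ⟩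
  entry' k (γ k N) * cofactor' k (γ k N)                      ≡⟨ cong₂ _*_ (entry'-γ k N) (cofactor'-γ k N) ⟩
  (cofactor k N - entry' k N) * cofactor' k N                 ≡⟨ [p-e]*c≡p*c-e*c (cofactor k N) (entry' k N) (cofactor' k N) ⟩
  cofactor k N * cofactor' k N - entry' k N * cofactor' k N   ≡⟨ cong (λ P → cofactor k N * cofactor' k N - P) (entry'*cofactor'≡product' k N) ⟩
  cofactor k N * cofactor' k N - product' N                   ∎
  where open ≡-Reasoning

balanced-γ : ∀ k {N} → Balanced N → Balanced (γ k N)
balanced-γ k {N} balanced = begin
  product (γ k N)                           ≡⟨ product-γ k N ⟩
  cofactor' k N * cofactor k N - product N  ≡⟨ cong₂ _-_ (*-comm (cofactor' k N) (cofactor k N)) balanced ⟩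
  cofactor k N * cofactor' k N - product' N ≡⟨ sym (product'-γ k N) ⟩
  product' (γ k N)                          ∎
  where open ≡-Reasoning

entry-positive : ∀ {N} → AllPositive N → ∀ k → 0ℤ < entry k N × 0ℤ < entry' k N
entry-positive (p , _ , _ , p' , _ , _) zero             = p , p'
entry-positive (_ , p , _ , _ , p' , _) (suc zero)       = p , p'
entry-positive (_ , _ , p , _ , _ , p') (suc (suc zero)) = p , p'

entry-mono : ∀ {N N'} → N ≤ₑ N' → ∀ k → entry k N ≤ entry k N' × entry' k N ≤ entry' k N'
entry-mono (h , _ , _ , h' , _ , _) zero             = h , h'
entry-mono (_ , h , _ , _ , h' , _) (suc zero)       = h , h'
entry-mono (_ , _ , h , _ , _ , h') (suc (suc zero)) = h , h'

≤ₑ-refl : ∀ {N} → N ≤ₑ N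
≤ₑ-refl = ≤-refl , ≤-refl , ≤-refl , ≤-refl , ≤-refl , ≤-refl

≤ₑ-trans : ∀ {N N' N''} → N ≤ₑ N' → N' ≤ₑ N'' → N ≤ₑ N''
≤ₑ-trans (h₁ , h₂ , h₃ , h₄ , h₅ , h₆) (k₁ , k₂ , k₃ , k₄ , k₅ , k₆) =
  ≤-trans h₁ k₁ , ≤-trans h₂ k₂ , ≤-trans h₃ k₃ , ≤-trans h₄ k₄ , ≤-trans h₅ k₅ , ≤-trans h₆ k₆

≤ₑ-antisym : ∀ {N N'} → N ≤ₑ N' → N' ≤ₑ N → N ≡ N'
≤ₑ-antisym (h₁ , h₂ , h₃ , h₄ , h₅ , h₆) (k₁ , k₂ , k₃ , k₄ , k₅ , k₆) =
  cong₆ (≤-antisym h₁ k₁) (≤-antisym h₂ k₂) (≤-antisym h₃ k₃)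
        (≤-antisym h₄ k₄) (≤-antisym h₅ k₅) (≤-antisym h₆ k₆)
  where
  cong₆ : ∀ {a b c a' b' c' d e f d' e' f'} → a ≡ d → b ≡ e → c ≡ f → a' ≡ d' → b' ≡ e' → c' ≡ f' →
          arr a b c a' b' c' ≡ arr d e f d' e' f'
  cong₆ refl refl refl refl refl refl = refl

AllPositive-mono : ∀ {N N'} → N ≤ₑ N' → AllPositive N → AllPositive N'
AllPositive-mono (h₁ , h₂ , h₃ , h₄ , h₅ , h₆) (p₁ , p₂ , p₃ , p₄ , p₅ , p₆) =
  <-≤-trans p₁ h₁ , <-≤-trans p₂ h₂ , <-≤-trans p₃ h₃ ,
  <-≤-trans p₄ h₄ , <-≤-trans p₅ h₅ , <-≤-trans p₆ h₆

IncreasingAt DecreasingAt : Fin 3 → Arr → Set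
IncreasingAt k N = + 2 * entry k N ≤ cofactor' k N × + 2 * entry' k N ≤ cofactor k N
DecreasingAt k N = cofactor' k N ≤ + 2 * entry k N × cofactor k N ≤ + 2 * entry' k N

Ample : Arr → Set
Ample N = AllPositive N × (∀ k → + 4 ≤ entry k N * entry' k N)

IncreasingAt⇒≤ₑγ : ∀ k {N} → IncreasingAt k N → N ≤ₑ γ k N
IncreasingAt⇒≤ₑγ zero             (h , h') = u≤p-u h , ≤-refl , ≤-refl , u≤p-u h' , ≤-refl , ≤-refl
IncreasingAt⇒≤ₑγ (suc zero)       (h , h') = ≤-refl , u≤p-u h , ≤-refl , ≤-refl , u≤p-u h' , ≤-refl
IncreasingAt⇒≤ₑγ (suc (suc zero)) (h , h') = ≤-refl , ≤-refl , u≤p-u h , ≤-refl , ≤-refl , u≤p-u h'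

IncreasingAt⇒DecreasingAt-γ : ∀ k {N} → IncreasingAt k N → DecreasingAt k (γ k N)
IncreasingAt⇒DecreasingAt-γ zero             (h , h') = p≤2[p-u] h , p≤2[p-u] h'
IncreasingAt⇒DecreasingAt-γ (suc zero)       (h , h') = p≤2[p-u] h , p≤2[p-u] h'
IncreasingAt⇒DecreasingAt-γ (suc (suc zero)) (h , h') = p≤2[p-u] h , p≤2[p-u] h'

Ample-mono : ∀ {N N'} → N ≤ₑ N' → Ample N → Ample N'
Ample-mono N≤N' (positive , ≥4) = AllPositive-mono N≤N' positive , λ k →
  ≤-trans (≥4 k) (*-mono-≤-nonNeg (<⇒≤ (proj₁ (entry-positive positive k)))
                                  (<⇒≤ (proj₂ (entry-positive positive k)))
                                  (proj₁ (entry-mono N≤N' k)) (proj₂ (entry-mono N≤N' k)))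

rotate : Arr → Arr
rotate N = arr (y N) (z N) (x N) (y' N) (z' N) (x' N)

Ample-rotate : ∀ {N} → Ample N → Ample (rotate N)
Ample-rotate ((p₁ , p₂ , p₃ , p₄ , p₅ , p₆) , ≥4) = (p₂ , p₃ , p₁ , p₅ , p₆ , p₄) , λ
  { zero             → ≥4 (suc zero)
  ; (suc zero)       → ≥4 (suc (suc zero))
  ; (suc (suc zero)) → ≥4 zero
  }

-- Column 0 stays increasing: if it was increasing, because its cofactors only grow; if it was
-- decreasing, because the column other than 0 and j has product xx' ≥ 4.
increasing-after-γ₁ : ∀ N → Ample N → IncreasingAt (suc zero) N →
                      IncreasingAt zero N ⊎ DecreasingAt zero N → IncreasingAt zero (γ (suc zero) N)
increasing-after-γ₁ (arr a b c a' b' c') ((_ , _ , 0<c , _ , _ , 0<c') , _) (2b≤c'a' , 2b'≤ca)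
                    (inj₁ (2a≤b'c' , 2a'≤bc)) =
  ≤-trans 2a≤b'c' (*-monoʳ-≤-positive 0<c' (u≤p-u 2b'≤ca)) ,
  ≤-trans 2a'≤bc (*-monoʳ-≤-positive 0<c (u≤p-u 2b≤c'a'))
increasing-after-γ₁ (arr a b c a' b' c') ((0<a , _ , _ , 0<a' , _ , _) , ≥4) _ (inj₂ (b'c'≤2a , bc≤2a')) =
  2u≤s*u-t (<⇒≤ 0<a) (≥4 (suc (suc zero))) b'c'≤2a (expand a b' c c') ,
  2u≤s*u-t (<⇒≤ 0<a') (≥4 (suc (suc zero))) bc≤2a' (expand' a' b c c')
  where
  expand : ∀ a b' c c' → c * c' * a - b' * c' ≡ (c * a - b') * c'
  expand = solve-∀
  expand' : ∀ a' b c c' → c * c' * a' - b * c ≡ (c' * a' - b) * c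
  expand' = solve-∀

increasing-after-γ₂ : ∀ N → Ample N → IncreasingAt (suc (suc zero)) N →
                      IncreasingAt zero N ⊎ DecreasingAt zero N → IncreasingAt zero (γ (suc (suc zero)) N)
increasing-after-γ₂ (arr a b c a' b' c') ((_ , 0<b , _ , _ , 0<b' , _) , _) (2c≤a'b' , 2c'≤ab)
                    (inj₁ (2a≤b'c' , 2a'≤bc)) =
  ≤-trans 2a≤b'c' (*-monoˡ-≤-positive 0<b' (u≤p-u 2c'≤ab)) ,
  ≤-trans 2a'≤bc (*-monoˡ-≤-positive 0<b (u≤p-u 2c≤a'b'))
increasing-after-γ₂ (arr a b c a' b' c') ((0<a , _ , _ , 0<a' , _ , _) , ≥4) _ (inj₂ (b'c'≤2a , bc≤2a')) =
  2u≤s*u-t (<⇒≤ 0<a) (≥4 (suc zero)) b'c'≤2a (expand a b b' c') ,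
  2u≤s*u-t (<⇒≤ 0<a') (≥4 (suc zero)) bc≤2a' (expand' a' b b' c)
  where
  expand : ∀ a b b' c' → b * b' * a - b' * c' ≡ b' * (a * b - c')
  expand = solve-∀
  expand' : ∀ a' b b' c → b * b' * a' - b * c ≡ b * (a' * b' - c)
  expand' = solve-∀

-- The other columns reduce to column 0: rotate (γ (k + 1) N) = γ k (rotate N) definitionally.
increasing-after-γ : ∀ i j {N} → ¬ i ≡ j → Ample N → IncreasingAt j N →
                     IncreasingAt i N ⊎ DecreasingAt i N → IncreasingAt i (γ j N)
increasing-after-γ zero             zero             i≢j = ⊥-elim (i≢j refl)
increasing-after-γ zero             (suc zero)       {N} _ = increasing-after-γ₁ N
increasing-after-γ zero             (suc (suc zero)) {N} _ = increasing-after-γ₂ N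
increasing-after-γ (suc zero)       zero             {N} _ ample =
  increasing-after-γ₂ (rotate N) (Ample-rotate ample)
increasing-after-γ (suc zero)       (suc zero)       i≢j = ⊥-elim (i≢j refl)
increasing-after-γ (suc zero)       (suc (suc zero)) {N} _ ample =
  increasing-after-γ₁ (rotate N) (Ample-rotate ample)
increasing-after-γ (suc (suc zero)) zero             {N} _ ample =
  increasing-after-γ₁ (rotate (rotate N)) (Ample-rotate (Ample-rotate ample))
increasing-after-γ (suc (suc zero)) (suc zero)       {N} _ ample =
  increasing-after-γ₂ (rotate (rotate N)) (Ample-rotate (Ample-rotate ample))
increasing-after-γ (suc (suc zero)) (suc (suc zero)) i≢j = ⊥-elim (i≢j refl)

ClimbingAfter : Fin 3 → Arr → Set
ClimbingAfter k N = Ample N × DecreasingAt k N × (∀ i → ¬ i ≡ k → IncreasingAt i N)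

climb : ∀ k {N} → Ample N → IncreasingAt k N → (∀ i → IncreasingAt i N ⊎ DecreasingAt i N) →
        N ≤ₑ γ k N × ClimbingAfter k (γ k N)
climb k {N} ample increasing monotone =
  N≤γN , Ample-mono N≤γN ample , IncreasingAt⇒DecreasingAt-γ k increasing ,
  λ i i≢k → increasing-after-γ i k i≢k ample increasing (monotone i)
  where
  N≤γN : N ≤ₑ γ k N
  N≤γN = IncreasingAt⇒≤ₑγ k increasing

ClimbingAfter⇒IncreasingAt⊎DecreasingAt : ∀ {k N} → ClimbingAfter k N → ∀ i → IncreasingAt i N ⊎ DecreasingAt i N
ClimbingAfter⇒IncreasingAt⊎DecreasingAt {k} (_ , decreasing , increasing) i with i ≟ k
... | yes refl = inj₂ decreasing
... | no i≢k   = inj₁ (increasing i i≢k)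

ClimbingAfter⇒≤ₑ-applySeq : ∀ k ts {N} → ClimbingAfter k N → NoAdjRepeat (k ∷ ts) → N ≤ₑ applySeq ts N
ClimbingAfter⇒≤ₑ-applySeq k [] _ _ = ≤ₑ-refl
ClimbingAfter⇒≤ₑ-applySeq k (j ∷ ts) c@(ample , _ , increasing) (k≢j , reduced)
  with climb j ample (increasing j (k≢j ∘ sym)) (ClimbingAfter⇒IncreasingAt⊎DecreasingAt c)
... | N≤γN , climbing = ≤ₑ-trans N≤γN (ClimbingAfter⇒≤ₑ-applySeq j ts climbing reduced)

FBound : Fin 3 → Arr → Set
FBound k N = + 2 * entry k N * entry' k N ≤ product N

FBound? : ∀ k N → Dec (FBound k N)
FBound? k N = + 2 * entry k N * entry' k N ≤? product N

InF⇒FBound : ∀ {M} → InF M → ∀ k → FBound k M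
InF⇒FBound (_ , f , _ , _) zero             = f
InF⇒FBound (_ , _ , f , _) (suc zero)       = f
InF⇒FBound (_ , _ , _ , f) (suc (suc zero)) = f

InMPlusZ⇒AllPositive : ∀ {M} → InMPlusZ M → AllPositive M
InMPlusZ⇒AllPositive (p₁ , p₂ , p₃ , p₄ , p₅ , p₆ , _) = p₁ , p₂ , p₃ , p₄ , p₅ , p₆

InMPlusZ⇒Balanced : ∀ {M} → InMPlusZ M → Balanced M
InMPlusZ⇒Balanced (_ , _ , _ , _ , _ , _ , balanced) = balanced

FBound⇔2e≤c' : ∀ {M} → InMPlusZ M → ∀ k → FBound k M ⇔ + 2 * entry k M ≤ cofactor' k M
FBound⇔2e≤c' {M} m k =
  *-cancelʳ-≤-⇔ (proj₂ (entry-positive (InMPlusZ⇒AllPositive m) k))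
                (trans (entry'*cofactor'≡product' k M) (sym (InMPlusZ⇒Balanced m))) refl

FBound⇔2e'≤c : ∀ {M} → InMPlusZ M → ∀ k → FBound k M ⇔ + 2 * entry' k M ≤ cofactor k M
FBound⇔2e'≤c {M} m k =
  *-cancelʳ-≤-⇔ (proj₁ (entry-positive (InMPlusZ⇒AllPositive m) k))
                (entry*cofactor≡product k M) (swap (entry k M) (entry' k M))
  where
  swap : ∀ e e' → + 2 * e * e' ≡ + 2 * e' * e
  swap = solve-∀

FBound⇒IncreasingAt : ∀ {M} → InMPlusZ M → ∀ k → FBound k M → IncreasingAt k M
FBound⇒IncreasingAt m k f = Equivalence.to (FBound⇔2e≤c' m k) f , Equivalence.to (FBound⇔2e'≤c m k) f

¬FBound⇒γ-shrinks : ∀ {M} → InMPlusZ M → ∀ k → ¬ FBound k M →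
                    entry k (γ k M) < entry k M × entry' k (γ k M) < entry' k M
¬FBound⇒γ-shrinks {M} m k ¬f =
  subst (_< entry k M) (sym (entry-γ k M))
        (p<2u⇒p-u<u (≰⇒> (λ h → ¬f (Equivalence.from (FBound⇔2e≤c' m k) h)))) ,
  subst (_< entry' k M) (sym (entry'-γ k M))
        (p<2u⇒p-u<u (≰⇒> (λ h → ¬f (Equivalence.from (FBound⇔2e'≤c m k) h))))

IncreasingAt-all⇒Ample : ∀ {M} → AllPositive M → (∀ k → IncreasingAt k M) → Ample M
IncreasingAt-all⇒Ample {M} positive@(0<a , 0<b , 0<c , 0<a' , 0<b' , 0<c') increasing = positive , λ where
  zero             → 2u≤vw⇒2v≤w'u⇒4≤w'w (x' M) (x M) 0<b 0<c' (proj₁ (increasing (suc zero))) (proj₂ (increasing (suc (suc zero))))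
  (suc zero)       → 2u≤vw⇒2v≤w'u⇒4≤w'w (y' M) (y M) 0<c 0<a' (proj₁ (increasing (suc (suc zero)))) (proj₂ (increasing zero))
  (suc (suc zero)) → 2u≤vw⇒2v≤w'u⇒4≤w'w (z' M) (z M) 0<a 0<b' (proj₁ (increasing zero)) (proj₂ (increasing (suc zero)))

InF⇒IncreasingAt : ∀ {M} → InF M → ∀ k → IncreasingAt k M
InF⇒IncreasingAt f k = FBound⇒IncreasingAt (proj₁ f) k (InF⇒FBound f k)

InF⇒Ample : ∀ {M} → InF M → Ample M
InF⇒Ample f = IncreasingAt-all⇒Ample (InMPlusZ⇒AllPositive (proj₁ f)) (InF⇒IncreasingAt f)

InF⇒≤ₑ-applySeq : ∀ {M} → InF M → ∀ ts → NoAdjRepeat ts → M ≤ₑ applySeq ts M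
InF⇒≤ₑ-applySeq f []       _ = ≤ₑ-refl
InF⇒≤ₑ-applySeq f (j ∷ ts) reduced
  with climb j (InF⇒Ample f) (InF⇒IncreasingAt f j) (inj₁ ∘ InF⇒IncreasingAt f)
... | M≤γM , climbing = ≤ₑ-trans M≤γM (ClimbingAfter⇒≤ₑ-applySeq j ts climbing reduced)

InF⇒≤ₑ-orbit : ∀ {M N} → InF M → InOrbit M N → M ≤ₑ N
InF⇒≤ₑ-orbit {M} f (ts , reduced , refl) = InF⇒≤ₑ-applySeq f ts reduced

InF⇒ClusterPositiveZ : ∀ {M} → InF M → ClusterPositiveZ M
InF⇒ClusterPositiveZ f = proj₁ f , λ N orbit →
  AllPositive-mono (InF⇒≤ₑ-orbit f orbit) (InMPlusZ⇒AllPositive (proj₁ f))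

Reachable : Arr → Arr → Set
Reachable M N = Σ (List (Fin 3)) λ ts → applySeq ts M ≡ N

p-[p-e]≡e : ∀ p e → p - (p - e) ≡ e
p-[p-e]≡e = solve-∀

γ-involutive : ∀ k M → γ k (γ k M) ≡ M
γ-involutive zero (arr a b c a' b' c')
  rewrite p-[p-e]≡e (b' * c') a | p-[p-e]≡e (b * c) a' = refl
γ-involutive (suc zero) (arr a b c a' b' c')
  rewrite p-[p-e]≡e (c' * a') b | p-[p-e]≡e (c * a) b' = refl
γ-involutive (suc (suc zero)) (arr a b c a' b' c')
  rewrite p-[p-e]≡e (a' * b') c | p-[p-e]≡e (a * b) c' = refl

applySeq-++ : ∀ ts us M → applySeq (ts ++ us) M ≡ applySeq us (applySeq ts M)
applySeq-++ []       us M = refl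
applySeq-++ (t ∷ ts) us M = applySeq-++ ts us (γ t M)

applySeq-reverse : ∀ ts M → applySeq (reverse ts) (applySeq ts M) ≡ M
applySeq-reverse []       M = refl
applySeq-reverse (t ∷ ts) M = begin
  applySeq (reverse (t ∷ ts)) N               ≡⟨ cong (λ us → applySeq us N) (unfold-reverse t ts) ⟩
  applySeq (reverse ts ++ t ∷ []) N           ≡⟨ applySeq-++ (reverse ts) (t ∷ []) N ⟩
  γ t (applySeq (reverse ts) N)               ≡⟨ cong (γ t) (applySeq-reverse ts (γ t M)) ⟩
  γ t (γ t M)                                 ≡⟨ γ-involutive t M ⟩
  M                                           ∎
  where
  open ≡-Reasoning
  N = applySeq ts (γ t M)

Reachable-trans : ∀ {M N P} → Reachable M N → Reachable N P → Reachable M P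
Reachable-trans {M} (ts , refl) (us , N↝P) = ts ++ us , trans (applySeq-++ ts us M) N↝P

Reachable-sym : ∀ {M N} → Reachable M N → Reachable N M
Reachable-sym {M} (ts , refl) = reverse ts , applySeq-reverse ts M

Reachable-γ : ∀ k {M N} → Reachable (γ k M) N → Reachable M N
Reachable-γ k (ts , γM↝N) = k ∷ ts , γM↝N

cancel-∷ : Fin 3 → List (Fin 3) → List (Fin 3)
cancel-∷ t []       = t ∷ []
cancel-∷ t (s ∷ ss) with t ≟ s
... | yes _ = ss
... | no  _ = t ∷ s ∷ ss

applySeq-cancel-∷ : ∀ t ts M → applySeq (cancel-∷ t ts) M ≡ applySeq ts (γ t M)
applySeq-cancel-∷ t []       M = refl
applySeq-cancel-∷ t (s ∷ ss) M with t ≟ s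
... | yes refl = cong (applySeq ss) (sym (γ-involutive t M))
... | no  _    = refl

NoAdjRepeat-cancel-∷ : ∀ t ts → NoAdjRepeat ts → NoAdjRepeat (cancel-∷ t ts)
NoAdjRepeat-cancel-∷ t []       _ = tt
NoAdjRepeat-cancel-∷ t (s ∷ ss) reduced with t ≟ s
NoAdjRepeat-cancel-∷ t (s ∷ [])     _             | yes _ = tt
NoAdjRepeat-cancel-∷ t (s ∷ u ∷ ss) (_ , reduced) | yes _ = reduced
... | no t≢s = t≢s , reduced

reduce : List (Fin 3) → List (Fin 3)
reduce []       = []
reduce (t ∷ ts) = cancel-∷ t (reduce ts)

applySeq-reduce : ∀ ts M → applySeq (reduce ts) M ≡ applySeq ts M
applySeq-reduce []       M = refl
applySeq-reduce (t ∷ ts) M = trans (applySeq-cancel-∷ t (reduce ts) M) (applySeq-reduce ts (γ t M))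

NoAdjRepeat-reduce : ∀ ts → NoAdjRepeat (reduce ts)
NoAdjRepeat-reduce []       = tt
NoAdjRepeat-reduce (t ∷ ts) = NoAdjRepeat-cancel-∷ t (reduce ts) (NoAdjRepeat-reduce ts)

Reachable⇒InOrbit : ∀ {M N} → Reachable M N → InOrbit M N
Reachable⇒InOrbit {M} (ts , M↝N) = reduce ts , NoAdjRepeat-reduce ts , trans (applySeq-reduce ts M) M↝N

InOrbit⇒Reachable : ∀ {M N} → InOrbit M N → Reachable M N
InOrbit⇒Reachable (ts , _ , M↝N) = ts , M↝N

InF⇒orbit-minimum : ∀ {M N N'} → InF N → InOrbit M N → InOrbit M N' → N ≤ₑ N'
InF⇒orbit-minimum f M↝N M↝N' = InF⇒≤ₑ-orbit f (Reachable⇒InOrbit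
  (Reachable-trans (Reachable-sym (InOrbit⇒Reachable M↝N)) (InOrbit⇒Reachable M↝N')))

InMPlusZ-intro : ∀ {M} → AllPositive M → Balanced M → InMPlusZ M
InMPlusZ-intro (p₁ , p₂ , p₃ , p₄ , p₅ , p₆) balanced = p₁ , p₂ , p₃ , p₄ , p₅ , p₆ , balanced

ClusterPositiveZ-γ : ∀ k {M} → ClusterPositiveZ M → ClusterPositiveZ (γ k M)
ClusterPositiveZ-γ k {M} (m , orbit-positive) =
  InMPlusZ-intro (orbit-positive (γ k M) (Reachable⇒InOrbit (k ∷ [] , refl)))
                 (balanced-γ k (InMPlusZ⇒Balanced m)) ,
  λ N γM↝N → orbit-positive N (Reachable⇒InOrbit (Reachable-γ k (InOrbit⇒Reachable γM↝N)))

sum : Arr → ℤ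
sum N = x N + y N + z N + x' N + y' N + z' N

size : Arr → ℕ.ℕ
size N = ∣ sum N ∣

0≤sum : ∀ {N} → AllPositive N → 0ℤ ≤ sum N
0≤sum (p₁ , p₂ , p₃ , p₄ , p₅ , p₆) =
  +-mono-≤ (+-mono-≤ (+-mono-≤ (+-mono-≤ (+-mono-≤ (<⇒≤ p₁) (<⇒≤ p₂)) (<⇒≤ p₃)) (<⇒≤ p₄)) (<⇒≤ p₅)) (<⇒≤ p₆)

sum-γ-< : ∀ k N → entry k (γ k N) < entry k N → entry' k (γ k N) < entry' k N → sum (γ k N) < sum N
sum-γ-< zero N e<x e'<x' =
  +-monoˡ-< (z' N) (+-monoˡ-< (y' N) (+-mono-< (+-monoˡ-< (z N) (+-monoˡ-< (y N) e<x)) e'<x'))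
sum-γ-< (suc zero) N e<y e'<y' =
  +-monoˡ-< (z' N) (+-mono-< (+-monoˡ-< (x' N) (+-monoˡ-< (z N) (+-monoʳ-< (x N) e<y))) e'<y')
sum-γ-< (suc (suc zero)) N e<z e'<z' =
  +-mono-< (+-monoˡ-< (y' N) (+-monoˡ-< (x' N) (+-monoʳ-< (x N + y N) e<z))) e'<z'

size-γ-< : ∀ k {M} → ClusterPositiveZ M → ¬ FBound k M → size (γ k M) ℕ.< size M
size-γ-< k {M} cp ¬f =
  0≤i⇒i<j⇒∣i∣<∣j∣ (0≤sum (InMPlusZ⇒AllPositive (proj₁ (ClusterPositiveZ-γ k cp))))
                   (sum-γ-< k M (proj₁ shrinks) (proj₂ shrinks))
  where
  shrinks : entry k (γ k M) < entry k M × entry' k (γ k M) < entry' k M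
  shrinks = ¬FBound⇒γ-shrinks (proj₁ cp) k ¬f

InF-or-violated : ∀ {M} → InMPlusZ M → InF M ⊎ Σ (Fin 3) λ k → ¬ FBound k M
InF-or-violated {M} m with FBound? zero M | FBound? (suc zero) M | FBound? (suc (suc zero)) M
... | yes f₀ | yes f₁ | yes f₂ = inj₁ (m , f₀ , f₁ , f₂)
... | no ¬f  | _      | _      = inj₂ (zero , ¬f)
... | yes _  | no ¬f  | _      = inj₂ (suc zero , ¬f)
... | yes _  | yes _  | no ¬f  = inj₂ (suc (suc zero) , ¬f)

descend : ∀ M → Acc ℕ._<_ (size M) → ClusterPositiveZ M → Σ Arr λ N → Reachable M N × InF N
descend M (acc smaller) cp with InF-or-violated (proj₁ cp)
... | inj₁ f        = M , ([] , refl) , f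
... | inj₂ (k , ¬f) with descend (γ k M) (smaller (size-γ-< k cp ¬f)) (ClusterPositiveZ-γ k cp)
...   | N , γM↝N , f = N , Reachable-γ k γM↝N , f

orbit-meets-F : ∀ {M} → ClusterPositiveZ M → Σ Arr λ N → InOrbit M N × InF N
orbit-meets-F {M} cp with descend M (<-wellFounded (size M)) cp
... | N , M↝N , f = N , Reachable⇒InOrbit M↝N , f

theorem9p7 :
    (∀ M → InF M → ClusterPositiveZ M)
    × (∀ M → ClusterPositiveZ M →
         Σ Arr λ N → (InOrbit M N × InF N)
           × (∀ N' → InOrbit M N' → InF N' → N' ≡ N)
           × (∀ N' → InOrbit M N' → N ≤ₑ N'))
theorem9p7 = (λ _ → InF⇒ClusterPositiveZ) , λ M cp →
  let (N , M↝N , f) = orbit-meets-F cp in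
  N , (M↝N , f) ,
  (λ N' M↝N' f' → ≤ₑ-antisym (InF⇒orbit-minimum f' M↝N' M↝N) (InF⇒orbit-minimum f M↝N M↝N')) ,
  (λ N' M↝N' → InF⇒orbit-minimum f M↝N M↝N')
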